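{- Let $l\geq 3$ and $n=2^l-1$. Let $G$ be one of $W_n$, $F_n$, $T_{\frac{n-1}{2}}$ or $S_n$, and let $H$ be either the $l$-level sibling tree $ST(l)$ or the $l$-level $X$-tree $XT_l$. Then $\mathrm{dil}(G,H)=l-1$, and $l-1$ equals the radius $r$ of $H$.
   Context: The wheel $W_n$ ($n$ vertices) consists of a cycle on $n-1$ vertices together with a hub vertex adjacent to every cycle vertex. The fan $F_n$ ($n$ vertices) consists of a path on $n-1$ vertices together with a core vertex adjacent to every path vertex. The friendship graph $T_m$ ($2m+1$ vertices) consists of $m$ triangles sharing exactly one common vertex. The star $S_n$ is $K_{1,n-1}$. The complete binary tree $T_l$ has $l$ levels, level $i$ containing $2^{i-1}$ vertices, every internal vertex having exactly two children (a left and a right child) and all leaves in level $l$; it has $2^l-1$ vertices. The sibling tree $ST(l)$ is obtained from $T_l$ by adding an edge between the left and right children of each parent. The $X$-tree $XT_l$ is obtained from $T_l$ by joining, in each level, each pair of consecutive vertices (in the left-to-right order of that level) by an edge. An embedding of $G$ into $H$ (with $|V(G)|=|V(H)|$) is a pair $(f,P_f)$ with $f:V(G)\to V(H)$ injective and $P_f$ assigning to each edge $uv\in E(G)$ a path in $H$ between $f(u)$ and $f(v)$; $\mathrm{dil}_f(e)$ is the length of $P_f(e)$ and $\mathrm{dil}(G,H)=\min_{(f,P_f)}\max_{e\in E(G)}\mathrm{dil}_f(e)$. The radius of $H$ is the minimum over vertices $v$ of $\max_{w} d_H(v,w)$. -}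

module Defs where

open import Data.Nat using (ℕ; zero; suc; _+_; _*_; _∸_; _^_; _≤_; _<_)
open import Data.Fin using (Fin; toℕ)
open import Data.List using (List; []; _∷_)
open import Data.List.Relation.Unary.Unique.Propositional using (Unique)
open import Data.Product using (Σ; ∃; _×_; _,_)
open import Data.Sum using (_⊎_)
open import Relation.Binary.PropositionalEquality using (_≡_)
open import Relation.Nullary using (¬_)
open import Function.Definitions using (Injective)

Graph : ℕ → Set₁
Graph n = Fin n → Fin n → Set

Sym : (ℕ → ℕ → Set) → ℕ → ℕ → Set
Sym R a b = R a b ⊎ R b a

-- Guest graphs G on n vertices, vertex v has label toℕ v ∈ {0,…,n-1};
-- label 0 is the hub / core / common vertex / star centre.

HubR : ℕ → ℕ → Set
HubR a b = a ≡ 0 × 1 ≤ b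

PathR : ℕ → ℕ → ℕ → Set
PathR n a b = 1 ≤ a × b ≡ suc a × b ≤ n ∸ 1

CloseR : ℕ → ℕ → ℕ → Set
CloseR n a b = a ≡ 1 × b ≡ n ∸ 1

TriR : ℕ → ℕ → Set
TriR a b = Σ ℕ λ k → 1 ≤ k × a ≡ 2 * k ∸ 1 × b ≡ 2 * k

onLabels : ∀ {n} → (ℕ → ℕ → Set) → Graph n
onLabels R u v = Sym R (toℕ u) (toℕ v)

Wheel : (n : ℕ) → Graph n
Wheel n = onLabels (λ a b → HubR a b ⊎ PathR n a b ⊎ CloseR n a b)

Fan : (n : ℕ) → Graph n
Fan n = onLabels (λ a b → HubR a b ⊎ PathR n a b)

-- friendship graph on n = 2m+1 vertices (m triangles sharing vertex 0)
Friendship : (n : ℕ) → Graph n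
Friendship n = onLabels (λ a b → HubR a b ⊎ TriR a b)

Star : (n : ℕ) → Graph n
Star n = onLabels HubR

-- Host graphs: complete binary tree in heap numbering.  Vertex v has
-- label toℕ v + 1 ∈ {1,…,2^l-1}; children of a are 2a (left) and 2a+1
-- (right); level i consists of labels 2^(i-1) … 2^i - 1 in left-to-right
-- order.

TreeR : ℕ → ℕ → Set
TreeR a b = b ≡ 2 * a ⊎ b ≡ suc (2 * a)

SiblingR : ℕ → ℕ → Set
SiblingR a b = Σ ℕ λ k → 1 ≤ k × a ≡ 2 * k × b ≡ suc (2 * k)

-- consecutive vertices a, a+1 in the same level (a+1 is not a power of 2)
LevelR : ℕ → ℕ → Set
LevelR a b = 1 ≤ a × b ≡ suc a × ¬ (Σ ℕ λ m → suc a ≡ 2 ^ m)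

onHeap : ∀ {n} → (ℕ → ℕ → Set) → Graph n
onHeap R u v = Sym R (suc (toℕ u)) (suc (toℕ v))

SiblingTree : (l : ℕ) → Graph (2 ^ l ∸ 1)
SiblingTree l = onHeap (λ a b → TreeR a b ⊎ SiblingR a b)

XTree : (l : ℕ) → Graph (2 ^ l ∸ 1)
XTree l = onHeap (λ a b → TreeR a b ⊎ LevelR a b)

data Walk {n} (H : Graph n) : Fin n → Fin n → Set where
  []  : ∀ {u} → Walk H u u
  _∷_ : ∀ {u v w} → H u v → Walk H v w → Walk H u w

len : ∀ {n} {H : Graph n} {u v} → Walk H u v → ℕ
len []       = 0
len (_ ∷ p)  = suc (len p)

verts : ∀ {n} {H : Graph n} {u v} → Walk H u v → List (Fin n)
verts {u = u} []       = u ∷ []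
verts {u = u} (_ ∷ p)  = u ∷ verts p

record Path {n} (H : Graph n) (u v : Fin n) : Set where
  constructor path
  field
    walk   : Walk H u v
    simple : Unique (verts walk)

plen : ∀ {n} {H : Graph n} {u v} → Path H u v → ℕ
plen p = len (Path.walk p)

record Embedding {n} (G H : Graph n) : Set where
  field
    f     : Fin n → Fin n
    f-inj : Injective _≡_ _≡_ f
    P     : ∀ u v → G u v → Path H (f u) (f v)

dilOf : ∀ {n} {G H : Graph n} (E : Embedding G H) {u v} → G u v → ℕ
dilOf E {u} {v} e = plen (Embedding.P E u v e)

Dilation : ∀ {n} → Graph n → Graph n → ℕ → Set
Dilation G H d =
  (Σ (Embedding G H) λ E → ∀ u v (e : G u v) → dilOf E e ≤ d)
  × (∀ (E : Embedding G H) → Σ _ λ u → Σ _ λ v → Σ (G u v) λ e → d ≤ dilOf E e)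

Radius : ∀ {n} → Graph n → ℕ → Set
Radius H r =
  (Σ _ λ v → ∀ w → Σ (Path H v w) λ p → plen p ≤ r)
  × (∀ v → Σ _ λ w → ∀ (p : Path H v w) → r ≤ plen p)

data GuestKind : Set where
  wheel fan friendship star : GuestKind

guest : GuestKind → (n : ℕ) → Graph n
guest wheel      n = Wheel n
guest fan        n = Fan n
guest friendship n = Friendship n
guest star       n = Star n

data HostKind : Set where
  sibling xtree : HostKind

host : HostKind → (l : ℕ) → Graph (2 ^ l ∸ 1)
host sibling l = SiblingTree l
host xtree   l = XTree l

module Submission where

-- Tree vertices are heap labels 1 … N = 2^l - 1; label 2^k + p (p < 2^k) is
-- the vertex at level k and position p.
--
-- The list root-first h orders all tree vertices, starting at
-- the root, such that consecutive vertices, and also the second and the last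
-- one, are at distance ≤ 2 in the sibling tree.  Mapping guest vertex i to
-- the i-th vertex sends the hub to the root (distance ≤ h from everything)
-- and all other guest edges to pairs at distance ≤ 2 ≤ h.  Sibling edges are
-- X-tree edges, so the same paths serve in XT(l).
--
-- The potentials bitlen p and bitlen (2^k - 1 - p), minus the
-- level k, change by at most one along every X-tree edge; at each vertex one
-- of them is ≥ k, while they vanish at the leftmost and the rightmost leaf
-- respectively.  So every vertex is at distance ≥ h from one of these leaves:
-- the radius is ≥ h (the root gives ≤ h), and since an injective map of the
-- vertices is onto, some spoke of the hub is stretched to length ≥ h.

open import Defs
open import Data.Nat using (ℕ; zero; suc; _+_; _*_; _∸_; _^_; _≤_; _<_; z≤n; s≤s; _≤?_; _≟_)
open import Data.Nat.Properties
open import Data.Nat.Logarithm using (⌊log₂_⌋; ⌊log₂⌋-mono-≤; ⌊log₂[2*b]⌋≡1+⌊log₂b⌋; ⌊log₂[2^n]⌋≡n)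
open import Data.Nat.Tactic.RingSolver using (solve-∀)
open import Data.Fin using (Fin; toℕ; fromℕ<; punchOut)
open import Data.Fin.Properties using (toℕ-injective; toℕ-fromℕ<; toℕ<n; pigeonhole; punchOut-injective; any?)
  renaming (_≟_ to _≟ᶠ_)
open import Data.Bool using (Bool; true; false)
open import Data.Maybe using (Maybe; just; nothing)
open import Data.List using (List; []; _∷_; _++_; _∷ʳ_; reverse; map; length)
open import Data.List.Properties using (unfold-reverse; length-map; length-++; ∷-injectiveʳ)
open import Data.List.Relation.Unary.All as All using (All; []; _∷_)
open import Data.List.Relation.Unary.AllPairs using ([]; _∷_)
import Data.List.Relation.Unary.All.Properties as AllP
open import Data.List.Relation.Unary.Unique.Propositional using (Unique)
import Data.List.Relation.Unary.Unique.Propositional.Properties as UniqueP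
open import Data.List.Relation.Binary.Disjoint.Propositional using (Disjoint)
open import Data.List.Relation.Binary.Permutation.Propositional using (↭⇒↭ₛ; ↭-sym)
open import Data.List.Relation.Binary.Permutation.Propositional.Properties using (↭-reverse)
open import Data.List.Relation.Binary.Permutation.Setoid.Properties using (Unique-resp-↭)
open import Data.Product using (Σ; ∃; _×_; _,_; proj₁; proj₂; swap)
open import Data.Sum as Sum using (_⊎_; inj₁; inj₂)
open import Data.Empty using (⊥-elim)
open import Relation.Binary.PropositionalEquality
open import Relation.Binary using (tri<; tri≈; tri>)
open import Relation.Nullary using (¬_; yes; no)
open import Function.Definitions using (Injective)

injective⇒surjective : ∀ {n} (f : Fin n → Fin n) → Injective _≡_ _≡_ f →
                       ∀ w → ∃ λ i → f i ≡ w
injective⇒surjective {zero}  f _     ()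
injective⇒surjective {suc n} f f-inj w with any? (λ i → f i ≟ᶠ w)
... | yes hit = hit
... | no miss = ⊥-elim (no-collision (pigeonhole (n<1+n n) (λ i → punchOut (w≢f i))))
  where
  w≢f : ∀ i → w ≢ f i
  w≢f i eq = miss (i , sym eq)

  no-collision : ¬ (Σ _ λ i → Σ _ λ j → toℕ i < toℕ j × punchOut (w≢f i) ≡ punchOut (w≢f j))
  no-collision (i , j , i<j , same) =
    <⇒≢ i<j (cong toℕ (f-inj (punchOut-injective (w≢f i) (w≢f j) same)))

ShortPath : ∀ {n} → Graph n → Fin n → Fin n → ℕ → Set
ShortPath H u v d = Σ (Path H u v) λ p → plen p ≤ d

weaken : ∀ {n} {H : Graph n} {u v d d′} → d ≤ d′ → ShortPath H u v d → ShortPath H u v d′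
weaken d≤d′ (p , p≤d) = p , ≤-trans p≤d d≤d′

edge-path : ∀ {n} {H : Graph n} {u v} → H u v → u ≢ v → ShortPath H u v 1
edge-path e u≢v = path (e ∷ []) ((u≢v ∷ []) ∷ [] ∷ []) , ≤-refl

two-edge-path : ∀ {n} {H : Graph n} {u z v} → H u z → H z v →
                u ≢ z → u ≢ v → z ≢ v → ShortPath H u v 2
two-edge-path e₁ e₂ u≢z u≢v z≢v =
  path (e₁ ∷ e₂ ∷ []) ((u≢z ∷ u≢v ∷ []) ∷ (z≢v ∷ []) ∷ [] ∷ []) , ≤-refl

module _ {n} {H : Graph n} (H-sym : ∀ {x y} → H x y → H y x) where

  private
    snoc : ∀ {u v w} → Walk H u v → H v w → Walk H u w
    snoc []      e = e ∷ []
    snoc (e′ ∷ p) e = e′ ∷ snoc p e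

    verts-snoc : ∀ {u v w} (p : Walk H u v) (e : H v w) → verts (snoc p e) ≡ verts p ∷ʳ w
    verts-snoc         []       e = refl
    verts-snoc {u = u} (e′ ∷ p) e = cong (u ∷_) (verts-snoc p e)

    len-snoc : ∀ {u v w} (p : Walk H u v) (e : H v w) → len (snoc p e) ≡ suc (len p)
    len-snoc []       e = refl
    len-snoc (e′ ∷ p) e = cong suc (len-snoc p e)

    backwards : ∀ {u v} → Walk H u v → Walk H v u
    backwards []      = []
    backwards (e ∷ p) = snoc (backwards p) (H-sym e)

    verts-backwards : ∀ {u v} (p : Walk H u v) → verts (backwards p) ≡ reverse (verts p)
    verts-backwards         []      = refl
    verts-backwards {u = u} (e ∷ p) = begin
      verts (snoc (backwards p) (H-sym e)) ≡⟨ verts-snoc (backwards p) (H-sym e) ⟩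
      verts (backwards p) ∷ʳ u             ≡⟨ cong (_∷ʳ u) (verts-backwards p) ⟩
      reverse (verts p) ∷ʳ u               ≡⟨ unfold-reverse u (verts p) ⟨
      reverse (u ∷ verts p)                ∎
      where open ≡-Reasoning

    len-backwards : ∀ {u v} (p : Walk H u v) → len (backwards p) ≡ len p
    len-backwards []      = refl
    len-backwards (e ∷ p) = trans (len-snoc (backwards p) (H-sym e)) (cong suc (len-backwards p))

    unique-reverse : ∀ {A : Set} {xs : List A} → Unique xs → Unique (reverse xs)
    unique-reverse {A} {xs} = Unique-resp-↭ (setoid A) (↭⇒↭ₛ (↭-sym (↭-reverse xs)))

  reverse-path : ∀ {u v d} → ShortPath H u v d → ShortPath H v u d
  reverse-path (path p simple , p≤d) =
    path (backwards p) (subst Unique (sym (verts-backwards p)) (unique-reverse simple)) ,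
    ≤-trans (≤-reflexive (len-backwards p)) p≤d

module _ {n} {H K : Graph n} (H⊆K : ∀ {x y} → H x y → K x y) where

  map-walk : ∀ {u v} → Walk H u v → Walk K u v
  map-walk []      = []
  map-walk (e ∷ p) = H⊆K e ∷ map-walk p

  len-map-walk : ∀ {u v} (p : Walk H u v) → len (map-walk p) ≡ len p
  len-map-walk []      = refl
  len-map-walk (e ∷ p) = cong suc (len-map-walk p)

  private
    verts-map-walk : ∀ {u v} (p : Walk H u v) → verts (map-walk p) ≡ verts p
    verts-map-walk         []      = refl
    verts-map-walk {u = u} (e ∷ p) = cong (u ∷_) (verts-map-walk p)

  map-path : ∀ {u v d} → ShortPath H u v d → ShortPath K u v d
  map-path (path p simple , p≤d) =
    path (map-walk p) (subst Unique (sym (verts-map-walk p)) simple) ,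
    ≤-trans (≤-reflexive (len-map-walk p)) p≤d

suc-pred-pos : ∀ {x} → 1 ≤ x → suc (x ∸ 1) ≡ x
suc-pred-pos {suc x} _ = refl

vertex-labelled : ∀ {n} a → 1 ≤ a → a ≤ n → Σ (Fin n) λ u → suc (toℕ u) ≡ a
vertex-labelled (suc a) _ a<n = fromℕ< a<n , cong suc (toℕ-fromℕ< a<n)

-- Heap coordinates: label a = 2^k + p with 0 ≤ p < 2^k means that a lies
-- on level k (counting the root as level 0) at position p from the left.

2^k+2^k : ∀ k → 2 ^ k + 2 ^ k ≡ 2 ^ suc k
2^k+2^k k = cong (2 ^ k +_) (sym (+-identityʳ (2 ^ k)))

level-bounded : ∀ k {p} → p < 2 ^ k → 2 ^ k + p < 2 ^ suc k
level-bounded k {p} p<2^k = subst (2 ^ k + p <_) (2^k+2^k k) (+-monoʳ-< (2 ^ k) p<2^k)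

private
  lower-level-smaller : ∀ {k p k′} p′ → k < k′ → p < 2 ^ k → 2 ^ k + p < 2 ^ k′ + p′
  lower-level-smaller {k} p′ k<k′ p<2^k =
    <-≤-trans (level-bounded k p<2^k) (≤-trans (^-monoʳ-≤ 2 k<k′) (m≤m+n _ p′))

coordinates-unique : ∀ {k p k′ p′} → p < 2 ^ k → p′ < 2 ^ k′ →
                     2 ^ k + p ≡ 2 ^ k′ + p′ → k ≡ k′ × p ≡ p′
coordinates-unique {k} {p} {k′} {p′} p<2^k p′<2^k′ eq with <-cmp k k′
... | tri< k<k′ _ _ = ⊥-elim (<⇒≢ (lower-level-smaller p′ k<k′ p<2^k) eq)
... | tri> _ _ k′<k = ⊥-elim (<⇒≢ (lower-level-smaller p k′<k p′<2^k′) (sym eq))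
... | tri≈ _ refl _ = refl , +-cancelˡ-≡ (2 ^ k) p p′ eq

last-on-level : ∀ k {p} → suc p ≡ 2 ^ k → suc (2 ^ k + p) ≡ 2 ^ suc k
last-on-level k {p} 1+p≡2^k = begin
  suc (2 ^ k + p)     ≡⟨ +-suc (2 ^ k) p ⟨
  2 ^ k + suc p       ≡⟨ cong (2 ^ k +_) 1+p≡2^k ⟩
  2 ^ k + 2 ^ k       ≡⟨ 2^k+2^k k ⟩
  2 ^ suc k           ∎
  where open ≡-Reasoning

coordinates : ∀ i → Σ ℕ λ k → Σ ℕ λ p → p < 2 ^ k × suc i ≡ 2 ^ k + p
coordinates zero = 0 , 0 , s≤s z≤n , refl
coordinates (suc i) with coordinates i
... | k , p , p<2^k , eq with m≤n⇒m<n∨m≡n p<2^k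
...   | inj₁ 1+p<2^k = k , suc p , 1+p<2^k , trans (cong suc eq) (sym (+-suc (2 ^ k) p))
...   | inj₂ 1+p≡2^k = suc k , 0 , m^n>0 2 (suc k) ,
  trans (cong suc eq) (trans (last-on-level k 1+p≡2^k) (sym (+-identityʳ (2 ^ suc k))))

level offset : ℕ → ℕ
level  i = proj₁ (coordinates i)
offset i = proj₁ (proj₂ (coordinates i))

offset<2^level : ∀ i → offset i < 2 ^ level i
offset<2^level i = proj₁ (proj₂ (proj₂ (coordinates i)))

label-coordinates : ∀ i → suc i ≡ 2 ^ level i + offset i
label-coordinates i = proj₂ (proj₂ (proj₂ (coordinates i)))

coordinates-of : ∀ {i k p} → p < 2 ^ k → suc i ≡ 2 ^ k + p → level i ≡ k × offset i ≡ p
coordinates-of {i} p<2^k eq =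
  coordinates-unique (offset<2^level i) p<2^k (trans (sym (label-coordinates i)) eq)

heap-vertex : ∀ h {k p} → k ≤ h → p < 2 ^ k →
              Σ (Fin (2 ^ suc h ∸ 1)) λ w → level (toℕ w) ≡ k × offset (toℕ w) ≡ p
heap-vertex h {k} {p} k≤h p<2^k with vertex-labelled {2 ^ suc h ∸ 1} (2 ^ k + p) positive fits
  where
  positive : 1 ≤ 2 ^ k + p
  positive = ≤-trans (m^n>0 2 k) (m≤m+n _ p)
  fits : 2 ^ k + p ≤ 2 ^ suc h ∸ 1
  fits = suc[m]≤n⇒m≤pred[n] (<-≤-trans (level-bounded k p<2^k) (^-monoʳ-≤ 2 (s≤s k≤h)))
... | w , label = w , coordinates-of p<2^k label

XEdge : ℕ → ℕ → Set
XEdge a b = TreeR a b ⊎ LevelR a b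

XHeap : (n : ℕ) → Graph n
XHeap n = onHeap XEdge

data XStep (k p : ℕ) : ℕ → ℕ → Set where
  to-left  : XStep k p (suc k) (2 * p)
  to-right : XStep k p (suc k) (suc (2 * p))
  to-next  : suc p < 2 ^ k → XStep k p k (suc p)

private
  arrive : ∀ {j k p k′ p′} → p′ < 2 ^ k′ → suc j ≡ 2 ^ k′ + p′ →
           XStep k p k′ p′ → XStep k p (level j) (offset j)
  arrive {j} {k′ = k′} {p′} bound label step with coordinates-of {j} {k′} {p′} bound label
  ... | refl , refl = step

xstep : ∀ i j → XEdge (suc i) (suc j) → XStep (level i) (offset i) (level j) (offset j)
xstep i j edge = step edge (offset<2^level i) (label-coordinates i)
  where
  step : ∀ {k p} → XEdge (suc i) (suc j) → p < 2 ^ k → suc i ≡ 2 ^ k + p →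
         XStep k p (level j) (offset j)
  step {k} {p} (inj₁ (inj₁ left)) p<2^k label = arrive (*-monoʳ-< 2 p<2^k) left-label to-left
    where
    left-label : suc j ≡ 2 ^ suc k + 2 * p
    left-label = trans left (trans (cong (2 *_) label) (*-distribˡ-+ 2 (2 ^ k) p))
  step {k} {p} (inj₁ (inj₂ right)) p<2^k label = arrive odd< right-label to-right
    where
    odd< : suc (2 * p) < 2 ^ suc k
    odd< = ≤-trans (≤-reflexive (sym (*-suc 2 p))) (*-monoʳ-≤ 2 p<2^k)
    right-label : suc j ≡ 2 ^ suc k + suc (2 * p)
    right-label = trans right (trans (cong (λ a → suc (2 * a)) label)
                    (trans (cong suc (*-distribˡ-+ 2 (2 ^ k) p)) (sym (+-suc _ _))))
  step {k} {p} (inj₂ (_ , next , not-power)) p<2^k label with m≤n⇒m<n∨m≡n p<2^k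
  ... | inj₁ 1+p<2^k = arrive 1+p<2^k next-label (to-next 1+p<2^k)
    where
    next-label : suc j ≡ 2 ^ k + suc p
    next-label = trans next (trans (cong suc label) (sym (+-suc (2 ^ k) p)))
  ... | inj₂ 1+p≡2^k = ⊥-elim (not-power (suc k , trans (cong suc label) (last-on-level k 1+p≡2^k)))

bitlen : ℕ → ℕ
bitlen zero        = 0
bitlen n@(suc _)   = suc ⌊log₂ n ⌋

bitlen-mono : ∀ {x y} → x ≤ y → bitlen x ≤ bitlen y
bitlen-mono {zero}          _   = z≤n
bitlen-mono {suc x} {suc y} x≤y = s≤s (⌊log₂⌋-mono-≤ x≤y)

bitlen-positive : ∀ {x} → 1 ≤ x → bitlen x ≡ suc ⌊log₂ x ⌋
bitlen-positive {suc x} _ = refl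

bitlen-2^ : ∀ j → bitlen (2 ^ j) ≡ suc j
bitlen-2^ j = trans (bitlen-positive (m^n>0 2 j)) (cong suc (⌊log₂[2^n]⌋≡n j))

bitlen-double : ∀ x → bitlen (2 * x) ≤ suc (bitlen x)
bitlen-double zero    = z≤n
bitlen-double (suc x) = ≤-reflexive (cong suc (⌊log₂[2*b]⌋≡1+⌊log₂b⌋ (suc x)))

bitlen-succ : ∀ x → bitlen (suc x) ≤ suc (bitlen x)
bitlen-succ zero    = ≤-reflexive (cong suc (⌊log₂[2^n]⌋≡n 0))
bitlen-succ (suc x) = ≤-trans (bitlen-mono 2+x≤2[1+x]) (bitlen-double (suc x))
  where
  2+x≤2[1+x] : suc (suc x) ≤ 2 * suc x
  2+x≤2[1+x] = ≤-trans (s≤s (s≤s (m≤n*m x 2))) (≤-reflexive (sym (*-suc 2 x)))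

bitlen-odd : ∀ x → bitlen (suc (2 * x)) ≤ 2 + bitlen x
bitlen-odd x = begin
  bitlen (suc (2 * x)) ≤⟨ bitlen-mono (≤-trans (n≤1+n _) (≤-reflexive (sym (*-suc 2 x)))) ⟩
  bitlen (2 * suc x)   ≤⟨ bitlen-double (suc x) ⟩
  suc (bitlen (suc x)) ≤⟨ s≤s (bitlen-succ x) ⟩
  2 + bitlen x         ∎
  where open ≤-Reasoning

-- A potential on heap coordinates whose value minus the level changes by at
-- most one along every X-tree edge.
Lipschitz : (ℕ → ℕ → ℕ) → Set
Lipschitz g = ∀ {k p k′ p′} → p < 2 ^ k → XStep k p k′ p′ →
              g k p + k′ ≤ suc (g k′ p′ + k) × g k′ p′ + k ≤ suc (g k p + k′)

private
  child-step : ∀ {x y} k → x ≤ y × y ≤ 2 + x →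
               x + suc k ≤ suc (y + k) × y + k ≤ suc (x + suc k)
  child-step {x} k (x≤y , y≤2+x) =
    ≤-trans (≤-reflexive (+-suc x k)) (s≤s (+-monoˡ-≤ k x≤y)) ,
    ≤-trans (+-monoˡ-≤ k y≤2+x) (≤-reflexive (cong suc (sym (+-suc x k))))

  bitlen-child : ∀ q {m} → m ≡ 2 * q ⊎ m ≡ suc (2 * q) →
                 bitlen q ≤ bitlen m × bitlen m ≤ 2 + bitlen q
  bitlen-child q (inj₁ refl) = bitlen-mono (m≤n*m q 2) , m≤n⇒m≤1+n (bitlen-double q)
  bitlen-child q (inj₂ refl) = bitlen-mono (≤-trans (m≤n*m q 2) (n≤1+n _)) , bitlen-odd q

  level-step : ∀ {x y} k → x ≤ suc y × y ≤ suc x → x + k ≤ suc (y + k) × y + k ≤ suc (x + k)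
  level-step k (x≤1+y , y≤1+x) = +-monoˡ-≤ k x≤1+y , +-monoˡ-≤ k y≤1+x

  bitlen-neighbours : ∀ a → bitlen a ≤ suc (bitlen (suc a)) × bitlen (suc a) ≤ suc (bitlen a)
  bitlen-neighbours a = m≤n⇒m≤1+n (bitlen-mono (n≤1+n a)) , bitlen-succ a

-- Measures how far (k,p) is from the left border: it vanishes at offset 0.
left-potential : ℕ → ℕ → ℕ
left-potential k p = bitlen p

left-potential-lipschitz : Lipschitz left-potential
left-potential-lipschitz {k} {p} _ to-left      = child-step k (bitlen-child p (inj₁ refl))
left-potential-lipschitz {k} {p} _ to-right     = child-step k (bitlen-child p (inj₂ refl))
left-potential-lipschitz {k} {p} _ (to-next _)  = level-step k (bitlen-neighbours p)

-- Its mirror image, vanishing at the last offset 2^k - 1.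
right-potential : ℕ → ℕ → ℕ
right-potential k p = bitlen (2 ^ k ∸ suc p)

private
  ∸-unfold : ∀ {m n} → n < m → m ∸ n ≡ suc (m ∸ suc n)
  ∸-unfold {suc m} {zero}  _         = refl
  ∸-unfold {suc m} {suc n} (s≤s n<m) = ∸-unfold n<m

  mirror-children : ∀ k {p} → p < 2 ^ k →
                    2 ^ suc k ∸ suc (2 * p) ≡ suc (2 * (2 ^ k ∸ suc p)) ×
                    2 ^ suc k ∸ suc (suc (2 * p)) ≡ 2 * (2 ^ k ∸ suc p)
  mirror-children k {p} p<2^k =
    trans (cong (λ a → 2 * a ∸ suc (2 * p)) 2^k≡q+p+1)
          (trans (cong (_∸ suc (2 * p)) (doubled-left q p)) (m+n∸n≡m (suc (2 * q)) (suc (2 * p)))) ,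
    trans (cong (λ a → 2 * a ∸ suc (suc (2 * p))) 2^k≡q+p+1)
          (trans (cong (_∸ suc (suc (2 * p))) (doubled-right q p)) (m+n∸n≡m (2 * q) (suc (suc (2 * p)))))
    where
    q : ℕ
    q = 2 ^ k ∸ suc p
    2^k≡q+p+1 : 2 ^ k ≡ q + suc p
    2^k≡q+p+1 = sym (m∸n+n≡m p<2^k)
    doubled-left : ∀ q p → 2 * (q + suc p) ≡ suc (2 * q) + suc (2 * p)
    doubled-left = solve-∀
    doubled-right : ∀ q p → 2 * (q + suc p) ≡ 2 * q + suc (suc (2 * p))
    doubled-right = solve-∀

right-potential-lipschitz : Lipschitz right-potential
right-potential-lipschitz {k} {p} p<2^k to-left =
  child-step k (bitlen-child (2 ^ k ∸ suc p) (inj₂ (proj₁ (mirror-children k p<2^k))))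
right-potential-lipschitz {k} {p} p<2^k to-right =
  child-step k (bitlen-child (2 ^ k ∸ suc p) (inj₁ (proj₂ (mirror-children k p<2^k))))
right-potential-lipschitz {k} {p} _ (to-next 1+p<2^k) =
  level-step k (subst (λ a → bitlen a ≤ suc (bitlen m) × bitlen m ≤ suc (bitlen a))
                      (sym (∸-unfold 1+p<2^k)) (swap (bitlen-neighbours m)))
  where
  m : ℕ
  m = 2 ^ k ∸ suc (suc p)

potential-large : ∀ k {p} → p < 2 ^ k → k ≤ left-potential k p ⊎ k ≤ right-potential k p
potential-large zero    _     = inj₁ z≤n
potential-large (suc j) {p} _ with 2 ^ j ≤? p
... | yes 2^j≤p = inj₁ (≤-trans (≤-reflexive (sym (bitlen-2^ j))) (bitlen-mono 2^j≤p))
... | no  2^j≰p = inj₂ (≤-trans (≤-reflexive (sym (bitlen-2^ j))) (bitlen-mono 2^j≤mirror))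
  where
  2^j≤mirror : 2 ^ j ≤ 2 ^ suc j ∸ suc p
  2^j≤mirror = begin
    2 ^ j               ≡⟨ m+n∸m≡n (2 ^ j) (2 ^ j) ⟨
    2 ^ j + 2 ^ j ∸ 2 ^ j ≡⟨ cong (_∸ 2 ^ j) (2^k+2^k j) ⟩
    2 ^ suc j ∸ 2 ^ j   ≤⟨ ∸-monoʳ-≤ (2 ^ suc j) (≰⇒> 2^j≰p) ⟩
    2 ^ suc j ∸ suc p   ∎
    where open ≤-Reasoning

module _ (g : ℕ → ℕ → ℕ) (g-lipschitz : Lipschitz g) where

  private
    Φ lvl : ∀ {n} → Fin n → ℕ
    Φ   u = g (level (toℕ u)) (offset (toℕ u))
    lvl u = level (toℕ u)

    edge-bound : ∀ {n} {u v : Fin n} → XHeap n u v → Φ u + lvl v ≤ suc (Φ v + lvl u)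
    edge-bound {u = u} (inj₁ e) = proj₁ (g-lipschitz (offset<2^level (toℕ u)) (xstep _ _ e))
    edge-bound {v = v} (inj₂ e) = proj₂ (g-lipschitz (offset<2^level (toℕ v)) (xstep _ _ e))

    -- Adding an edge bound and a walk bound.
    telescope : ∀ a b c d e f L → a + c ≤ suc (b + d) → b + e ≤ L + (f + c) →
                a + e ≤ suc L + (f + d)
    telescope a b c d e f L first rest = +-cancelʳ-≤ (b + c) (a + e) (suc L + (f + d)) (begin
      a + e + (b + c)             ≡⟨ regroup₁ a b c e ⟩
      a + c + (b + e)             ≤⟨ +-mono-≤ first rest ⟩
      suc (b + d) + (L + (f + c)) ≡⟨ regroup₂ b c d f L ⟩
      suc L + (f + d) + (b + c)   ∎)
      where
      open ≤-Reasoning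
      regroup₁ : ∀ a b c e → a + e + (b + c) ≡ a + c + (b + e)
      regroup₁ = solve-∀
      regroup₂ : ∀ b c d f L → suc (b + d) + (L + (f + c)) ≡ suc L + (f + d) + (b + c)
      regroup₂ = solve-∀

  walk-bound : ∀ {n} {u v : Fin n} (w : Walk (XHeap n) u v) → Φ u + lvl v ≤ len w + (Φ v + lvl u)
  walk-bound []                        = ≤-refl
  walk-bound {u = u} {v} (_∷_ {v = z} e w) =
    telescope (Φ u) (Φ z) (lvl z) (lvl u) (lvl v) (Φ v) (len w) (edge-bound e) (walk-bound w)

  walk-long : ∀ {n h} {v w : Fin n} → lvl v ≤ Φ v → Φ w ≡ 0 → lvl w ≡ h →
              (p : Walk (XHeap n) v w) → h ≤ len p
  walk-long {h = h} {v} {w} large flat deep p = +-cancelˡ-≤ (Φ v) h (len p) (begin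
    Φ v + h                 ≡⟨ cong (Φ v +_) deep ⟨
    Φ v + lvl w             ≤⟨ walk-bound p ⟩
    len p + (Φ w + lvl v)   ≡⟨ cong (λ x → len p + (x + lvl v)) flat ⟩
    len p + lvl v           ≤⟨ +-monoʳ-≤ (len p) large ⟩
    len p + Φ v             ≡⟨ +-comm (len p) (Φ v) ⟩
    Φ v + len p             ∎)
    where open ≤-Reasoning

-- In the X-tree with h + 1 levels every vertex is at distance at least h
-- from the leftmost or from the rightmost leaf.
far-vertex : ∀ h (v : Fin (2 ^ suc h ∸ 1)) →
             Σ _ λ w → ∀ (p : Walk (XHeap (2 ^ suc h ∸ 1)) v w) → h ≤ len p
far-vertex h v with potential-large (level (toℕ v)) (offset<2^level (toℕ v))
... | inj₁ large with heap-vertex h ≤-refl (m^n>0 2 h)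
...   | w , at-h , at-0 =
  w , walk-long left-potential left-potential-lipschitz large (cong bitlen at-0) at-h
far-vertex h v | inj₂ large with heap-vertex h ≤-refl last<2^h
  where
  last<2^h : 2 ^ h ∸ 1 < 2 ^ h
  last<2^h = ≤-reflexive (suc-pred-pos (m^n>0 2 h))
...   | w , at-h , at-last =
  w , walk-long right-potential right-potential-lipschitz large vanishes at-h
  where
  vanishes : bitlen (2 ^ level (toℕ w) ∸ suc (offset (toℕ w))) ≡ 0
  vanishes = begin
    bitlen (2 ^ level (toℕ w) ∸ suc (offset (toℕ w)))
      ≡⟨ cong₂ (λ k p → bitlen (2 ^ k ∸ suc p)) at-h at-last ⟩
    bitlen (2 ^ h ∸ suc (2 ^ h ∸ 1))
      ≡⟨ cong (λ x → bitlen (2 ^ h ∸ x)) (suc-pred-pos (m^n>0 2 h)) ⟩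
    bitlen (2 ^ h ∸ 2 ^ h)
      ≡⟨ cong bitlen (n∸n≡0 (2 ^ h)) ⟩
    0 ∎
    where open ≡-Reasoning

-- Addresses: a vertex of the complete binary tree is reached from the root
-- by a word over {false = left child, true = right child}.

Address : Set
Address = List Bool

descend : ℕ → Address → ℕ
descend a []          = a
descend a (false ∷ s) = descend (2 * a) s
descend a (true ∷ s)  = descend (suc (2 * a)) s

position : Address → ℕ
position []          = 0
position (false ∷ s) = position s
position (true ∷ s)  = 2 ^ length s + position s

position< : ∀ s → position s < 2 ^ length s
position< []          = s≤s z≤n
position< (false ∷ s) = ≤-trans (position< s) (m≤m+n _ _)
position< (true ∷ s)  = begin-strict
  2 ^ length s + position s   <⟨ +-monoʳ-< (2 ^ length s) (position< s) ⟩
  2 ^ length s + 2 ^ length s ≡⟨ 2^k+2^k (length s) ⟩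
  2 ^ suc (length s)          ∎
  where open ≤-Reasoning

descend-closed : ∀ a s → descend a s ≡ a * 2 ^ length s + position s
descend-closed a []          = unit a
  where
  unit : ∀ a → a ≡ a * 1 + 0
  unit = solve-∀
descend-closed a (false ∷ s) = trans (descend-closed (2 * a) s) (shift a (2 ^ length s) (position s))
  where
  shift : ∀ a x v → 2 * a * x + v ≡ a * (2 * x) + v
  shift = solve-∀
descend-closed a (true ∷ s)  = trans (descend-closed (suc (2 * a)) s) (shift a (2 ^ length s) (position s))
  where
  shift : ∀ a x v → suc (2 * a) * x + v ≡ a * (2 * x) + (x + v)
  shift = solve-∀

address-label : ∀ s → descend 1 s ≡ 2 ^ length s + position s
address-label s = trans (descend-closed 1 s) (cong (_+ position s) (*-identityˡ _))

descend-≥ : ∀ a s → a ≤ descend a s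
descend-≥ a []          = ≤-refl
descend-≥ a (false ∷ s) = ≤-trans (m≤n*m a 2) (descend-≥ (2 * a) s)
descend-≥ a (true ∷ s)  = ≤-trans (≤-trans (m≤n*m a 2) (n≤1+n _)) (descend-≥ (suc (2 * a)) s)

private
  right-half-large : ∀ {x y p q} → x ≡ y → y + p ≡ q → x ≤ q
  right-half-large refl refl = m≤m+n _ _

position-injective : ∀ s t → length s ≡ length t → position s ≡ position t → s ≡ t
position-injective []          []          _    _   = refl
position-injective (false ∷ s) (false ∷ t) same pos =
  cong (false ∷_) (position-injective s t (suc-injective same) pos)
position-injective (true ∷ s)  (true ∷ t)  same pos =
  cong (true ∷_) (position-injective s t (suc-injective same) (+-cancelˡ-≡ (2 ^ length s) _ _
    (trans pos (cong (λ k → 2 ^ k + position t) (sym (suc-injective same))))))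
position-injective (false ∷ s) (true ∷ t)  same pos =
  ⊥-elim (<⇒≱ (position< s) (right-half-large (cong (2 ^_) (suc-injective same)) (sym pos)))
position-injective (true ∷ s)  (false ∷ t) same pos =
  ⊥-elim (<⇒≱ (position< t) (right-half-large (cong (2 ^_) (sym (suc-injective same))) pos))

address-injective : ∀ s t → descend 1 s ≡ descend 1 t → s ≡ t
address-injective s t same-label
  with coordinates-unique (position< s) (position< t)
         (trans (sym (address-label s)) (trans same-label (address-label t)))
... | same-level , same-offset = position-injective s t same-level same-offset

-- root-first h lists the addresses of length ≤ h, starting with the root;
-- root-last h lists them in reverse order, ending with the root.

root-first root-last : ℕ → List Address
root-first zero    = [] ∷ []
root-first (suc h) = [] ∷ (map (false ∷_) (root-last h) ++ map (true ∷_) (root-last h))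
root-last  zero    = [] ∷ []
root-last  (suc h) = map (true ∷_) (root-first h) ++ (map (false ∷_) (root-first h) ++ [] ∷ [])

private
  first-letter : Address → Maybe Bool
  first-letter []      = nothing
  first-letter (b ∷ _) = just b

  prefixed : ∀ b xs → All (λ s → first-letter s ≡ just b) (map (b ∷_) xs)
  prefixed b []       = []
  prefixed b (x ∷ xs) = refl ∷ prefixed b xs

  avoiding : ∀ {b c xs} → c ≢ just b → All (λ s → first-letter s ≡ just b) xs →
             All (λ s → first-letter s ≢ c) xs
  avoiding c≢b = All.map (λ is-b is-c → c≢b (trans (sym is-c) is-b))

  separated : ∀ {c xs ys} → All (λ s → first-letter s ≡ c) xs →
              All (λ s → first-letter s ≢ c) ys → Disjoint xs ys
  separated all-c none-c (s∈xs , s∈ys) = All.lookup none-c s∈ys (All.lookup all-c s∈xs)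

  unique-prefixed : ∀ b {xs : List Address} → Unique xs → Unique (map (b ∷_) xs)
  unique-prefixed b = UniqueP.map⁺ {f = b ∷_} ∷-injectiveʳ

  two-copies : ∀ b b′ (xs : List Address) →
               length (map (b ∷_) xs ++ map (b′ ∷_) xs) ≡ length xs + length xs
  two-copies b b′ xs = trans (length-++ (map (b ∷_) xs)) (cong₂ _+_ (length-map _ xs) (length-map _ xs))

  three-parts : ∀ b b′ (xs : List Address) →
                length (map (b ∷_) xs ++ (map (b′ ∷_) xs ++ [] ∷ [])) ≡ length xs + (length xs + 1)
  three-parts b b′ xs = trans (length-++ (map (b ∷_) xs)) (cong₂ _+_ (length-map _ xs)
    (trans (length-++ (map (b′ ∷_) xs)) (cong (_+ 1) (length-map _ xs))))

  doubling : ∀ {x} k → suc x ≡ 2 ^ k → suc (suc (x + x)) ≡ 2 ^ suc k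
  doubling {x} k 1+x≡2^k =
    trans (cong suc (sym (+-suc x x))) (trans (cong₂ _+_ 1+x≡2^k 1+x≡2^k) (2^k+2^k k))

root-first-unique : ∀ h → Unique (root-first h)
root-last-unique  : ∀ h → Unique (root-last h)
root-first-unique zero    = [] ∷ []
root-first-unique (suc h) =
  All.map (λ not-root is-root → not-root (cong first-letter (sym is-root))) not-roots
  ∷ UniqueP.++⁺ (unique-prefixed false (root-last-unique h)) (unique-prefixed true (root-last-unique h))
                (separated (prefixed false _) (avoiding (λ ()) (prefixed true _)))
  where
  not-roots : All (λ s → first-letter s ≢ nothing)
                  (map (false ∷_) (root-last h) ++ map (true ∷_) (root-last h))
  not-roots = AllP.++⁺ (avoiding (λ ()) (prefixed false (root-last h)))
                       (avoiding (λ ()) (prefixed true (root-last h)))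
root-last-unique zero    = [] ∷ []
root-last-unique (suc h) =
  UniqueP.++⁺ (unique-prefixed true (root-first-unique h))
             (UniqueP.++⁺ (unique-prefixed false (root-first-unique h)) ([] ∷ [])
                         (separated (prefixed false _) ((λ ()) ∷ [])))
             (separated (prefixed true _) (AllP.++⁺ (avoiding (λ ()) (prefixed false _)) ((λ ()) ∷ [])))

root-first-length : ∀ h → suc (length (root-first h)) ≡ 2 ^ suc h
root-last-length  : ∀ h → suc (length (root-last h)) ≡ 2 ^ suc h
root-first-length zero    = refl
root-first-length (suc h) = begin
  suc (suc (length (map (false ∷_) (root-last h) ++ map (true ∷_) (root-last h))))
    ≡⟨ cong (λ n → suc (suc n)) (two-copies false true (root-last h)) ⟩
  suc (suc (length (root-last h) + length (root-last h)))
    ≡⟨ doubling (suc h) (root-last-length h) ⟩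
  2 ^ suc (suc h) ∎
  where open ≡-Reasoning
root-last-length zero    = refl
root-last-length (suc h) = begin
  suc (length (map (true ∷_) (root-first h) ++ (map (false ∷_) (root-first h) ++ [] ∷ [])))
    ≡⟨ cong suc (three-parts true false (root-first h)) ⟩
  suc (length (root-first h) + (length (root-first h) + 1))
    ≡⟨ regroup (length (root-first h)) ⟩
  suc (suc (length (root-first h) + length (root-first h)))
    ≡⟨ doubling (suc h) (root-first-length h) ⟩
  2 ^ suc (suc h) ∎
  where
  open ≡-Reasoning
  regroup : ∀ n → suc (n + (n + 1)) ≡ suc (suc (n + n))
  regroup = solve-∀

private
  deeper : ∀ b {h} {xs : List Address} → All (λ s → length s ≤ h) xs →
           All (λ s → length s ≤ suc h) (map (b ∷_) xs)
  deeper b bounded = AllP.map⁺ (All.map s≤s bounded)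

root-first-depth : ∀ h → All (λ s → length s ≤ h) (root-first h)
root-last-depth  : ∀ h → All (λ s → length s ≤ h) (root-last h)
root-first-depth zero    = z≤n ∷ []
root-first-depth (suc h) =
  z≤n ∷ AllP.++⁺ (deeper false (root-last-depth h)) (deeper true (root-last-depth h))
root-last-depth zero    = z≤n ∷ []
root-last-depth (suc h) = AllP.++⁺ (deeper true (root-first-depth h))
                                   (AllP.++⁺ (deeper false (root-first-depth h)) (z≤n ∷ []))

-- Pairs of addresses whose vertices are at distance at most 2 in the
-- sibling tree below any common prefix.
data Close : Address → Address → Set where
  child      : Close [] (false ∷ [])
  grandchild : Close [] (false ∷ true ∷ [])
  sibling    : Close (false ∷ []) (true ∷ [])
  nephew     : Close (false ∷ []) (true ∷ true ∷ [])
  nephew′    : Close (true ∷ []) (false ∷ true ∷ [])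
  flip       : ∀ {s t} → Close s t → Close t s
  below      : ∀ {s t} b → Close s t → Close (b ∷ s) (b ∷ t)

data Chain : Address → Address → List Address → Set where
  single : ∀ x → Chain x x (x ∷ [])
  step   : ∀ {x y z xs} → Close x y → Chain y z xs → Chain x z (x ∷ xs)

chain-below : ∀ b {x y xs} → Chain x y xs → Chain (b ∷ x) (b ∷ y) (map (b ∷_) xs)
chain-below b (single x)    = single (b ∷ x)
chain-below b (step c rest) = step (below b c) (chain-below b rest)

chain-++ : ∀ {x y x′ y′ xs ys} → Chain x y xs → Close y x′ → Chain x′ y′ ys → Chain x y′ (xs ++ ys)
chain-++ (single x)    c next = step c next
chain-++ (step c′ rest) c next = step c′ (chain-++ rest c next)

-- The right child of the root, or the root itself when there is no child:
-- where root-first h ends and root-last h begins.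
corner : ℕ → Address
corner zero    = []
corner (suc h) = true ∷ []

private
  into-left : ∀ h → Close [] (false ∷ corner h)
  into-left zero    = child
  into-left (suc h) = grandchild

  left-to-right : ∀ h → Close (false ∷ []) (true ∷ corner h)
  left-to-right zero    = sibling
  left-to-right (suc h) = nephew

root-first-chain : ∀ h → Chain [] (corner h) (root-first h)
root-last-chain  : ∀ h → Chain (corner h) [] (root-last h)
root-first-chain zero    = single []
root-first-chain (suc h) =
  step (into-left h) (chain-++ (chain-below false (root-last-chain h)) (left-to-right h)
                               (chain-below true (root-last-chain h)))
root-last-chain zero    = single []
root-last-chain (suc h) =
  chain-++ (chain-below true (root-first-chain h)) (flip (left-to-right h))
           (chain-++ (chain-below false (root-first-chain h)) (flip (into-left h)) (single []))

-- The entry of a list at index i (the root for out-of-range indices).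
at : List Address → ℕ → Address
at []       _       = []
at (x ∷ xs) zero    = x
at (x ∷ xs) (suc i) = at xs i

at-all : ∀ {P : Address → Set} xs i → All P xs → P [] → P (at xs i)
at-all []       i       _          p[] = p[]
at-all (x ∷ xs) zero    (px ∷ _)   _   = px
at-all (x ∷ xs) (suc i) (_ ∷ rest) p[] = at-all xs i rest p[]

private
  not-at : ∀ {x : Address} xs j → All (x ≢_) xs → j < length xs → x ≢ at xs j
  not-at (y ∷ ys) zero    (x≢y ∷ _)  _        = x≢y
  not-at (y ∷ ys) (suc j) (_ ∷ rest) (s≤s j<) = not-at ys j rest j<

at-injective : ∀ xs i j → Unique xs → i < length xs → j < length xs → at xs i ≡ at xs j → i ≡ j
at-injective (x ∷ xs) zero    zero    _          _        _        _    = refl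
at-injective (x ∷ xs) zero    (suc j) (x∉xs ∷ _) _        (s≤s j<) same =
  ⊥-elim (not-at xs j x∉xs j< same)
at-injective (x ∷ xs) (suc i) zero    (x∉xs ∷ _) (s≤s i<) _        same =
  ⊥-elim (not-at xs i x∉xs i< (sym same))
at-injective (x ∷ xs) (suc i) (suc j) (_ ∷ u)    (s≤s i<) (s≤s j<) same =
  cong suc (at-injective xs i j u i< j< same)

chain-step : ∀ {x y xs} → Chain x y xs → ∀ i → suc i < length xs → Close (at xs i) (at xs (suc i))
chain-step (single x)                  i       (s≤s ())
chain-step (step c (single _))         zero    _        = c
chain-step (step c (step _ _))         zero    _        = c
chain-step (step c rest)               (suc i) (s≤s i<) = chain-step rest i i<

chain-end : ∀ {x y xs} → Chain x y xs → at xs (length xs ∸ 1) ≡ y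
chain-end (single x)               = refl
chain-end (step c (single y))      = refl
chain-end (step c rest@(step _ _)) = chain-end rest

private
  root-first-starts : ∀ h → Σ (List Address) λ rest → root-first h ≡ [] ∷ rest
  root-first-starts zero    = _ , refl
  root-first-starts (suc h) = _ , refl

root-first-second : ∀ m → at (root-first (suc (suc m))) 1 ≡ false ∷ true ∷ []
root-first-second m with root-first m | root-first-starts m
... | _ | _ , refl = refl

SibEdge : ℕ → ℕ → Set
SibEdge a b = TreeR a b ⊎ SiblingR a b

SibHeap : (n : ℕ) → Graph n
SibHeap n = onHeap SibEdge

sib-sym : ∀ {n} {u v : Fin n} → SibHeap n u v → SibHeap n v u
sib-sym = Sum.swap

sibling⇒level : ∀ a b → SiblingR a b → LevelR a b
sibling⇒level .(2 * k) .(suc (2 * k)) (k , 1≤k , refl , refl) = 1≤2k , refl , not-power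
  where
  1≤2k : 1 ≤ 2 * k
  1≤2k = ≤-trans 1≤k (m≤n*m k 2)
  not-power : ¬ (Σ ℕ λ m → suc (2 * k) ≡ 2 ^ m)
  not-power (zero  , odd≡1)    = <⇒≢ 1≤2k (sym (suc-injective odd≡1))
  not-power (suc m , odd≡even) = even≢odd (2 ^ m) k (sym odd≡even)

sib⊆x : ∀ {n} {u v : Fin n} → SibHeap n u v → XHeap n u v
sib⊆x = Sum.map lift lift
  where
  lift : ∀ {a b} → SibEdge a b → XEdge a b
  lift = Sum.map₂ (sibling⇒level _ _)

private
  label-bound : ∀ {n} (v : Fin n) {y} → suc (toℕ v) ≡ y → y ≤ n
  label-bound v refl = toℕ<n v

  labelled-edge : ∀ {n} {u v : Fin n} {x y} → suc (toℕ u) ≡ x → suc (toℕ v) ≡ y →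
                  Sym SibEdge x y → SibHeap n u v
  labelled-edge refl refl e = e

  distinct : ∀ {n} {u v : Fin n} {x y} → suc (toℕ u) ≡ x → suc (toℕ v) ≡ y → x ≢ y → u ≢ v
  distinct refl refl x≢y refl = x≢y refl

  one-edge : ∀ {n} {u v : Fin n} {x y} → suc (toℕ u) ≡ x → suc (toℕ v) ≡ y →
             Sym SibEdge x y → x < y → ShortPath (SibHeap n) u v 2
  one-edge eu ev e x<y =
    weaken (s≤s z≤n) (edge-path (labelled-edge eu ev e) (distinct eu ev (<⇒≢ x<y)))

  two-edges : ∀ {n} {u v : Fin n} {x y} z → suc (toℕ u) ≡ x → suc (toℕ v) ≡ y →
              Sym SibEdge x z → Sym SibEdge z y → 1 ≤ z → x ≢ z → x < y → z < y →
              ShortPath (SibHeap n) u v 2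
  two-edges {n} {v = v} z eu ev e₁ e₂ 1≤z x≢z x<y z<y
    with vertex-labelled {n} z 1≤z (≤-trans (<⇒≤ z<y) (label-bound v ev))
  ... | w , ew = two-edge-path (labelled-edge eu ew e₁) (labelled-edge ew ev e₂)
                   (distinct eu ew x≢z) (distinct eu ev (<⇒≢ x<y)) (distinct ew ev (<⇒≢ z<y))

  a<2a : ∀ {a} → 1 ≤ a → a < 2 * a
  a<2a {a} 1≤a = m<m+n a (≤-trans 1≤a (≤-reflexive (sym (+-identityʳ a))))

  a<1+2a : ∀ a → a < suc (2 * a)
  a<1+2a a = s≤s (m≤m+n a _)

  1≤2a : ∀ {a} → 1 ≤ a → 1 ≤ 2 * a
  1≤2a {a} 1≤a = ≤-trans 1≤a (m≤n*m a 2)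

close-path : ∀ {n s t} → Close s t → ∀ a → 1 ≤ a → (u v : Fin n) →
             suc (toℕ u) ≡ descend a s → suc (toℕ v) ≡ descend a t → ShortPath (SibHeap n) u v 2
close-path child      a 1≤a u v eu ev = one-edge eu ev (inj₁ (inj₁ (inj₁ refl))) (a<2a 1≤a)
close-path grandchild a 1≤a u v eu ev =
  two-edges (2 * a) eu ev (inj₁ (inj₁ (inj₁ refl))) (inj₁ (inj₁ (inj₂ refl))) (1≤2a 1≤a)
            (<⇒≢ (a<2a 1≤a)) (<-trans (a<2a 1≤a) (a<1+2a _)) (a<1+2a _)
close-path sibling    a 1≤a u v eu ev = one-edge eu ev (inj₁ (inj₂ (a , 1≤a , refl , refl))) (n<1+n _)
close-path nephew     a 1≤a u v eu ev =
  two-edges (suc (2 * a)) eu ev (inj₁ (inj₂ (a , 1≤a , refl , refl))) (inj₁ (inj₁ (inj₂ refl))) (s≤s z≤n)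
            (<⇒≢ (n<1+n _)) (<-trans (n<1+n _) (a<1+2a _)) (a<1+2a _)
close-path nephew′    a 1≤a u v eu ev =
  two-edges (2 * a) eu ev (inj₂ (inj₂ (a , 1≤a , refl , refl))) (inj₁ (inj₁ (inj₂ refl))) (1≤2a 1≤a)
            (λ eq → <⇒≢ (n<1+n _) (sym eq)) (s≤s (a<2a (1≤2a 1≤a))) (a<1+2a _)
close-path (flip c)        a 1≤a u v eu ev = reverse-path sib-sym (close-path c a 1≤a v u ev eu)
close-path (below false c) a 1≤a u v eu ev = close-path c (2 * a) (1≤2a 1≤a) u v eu ev
close-path (below true c)  a 1≤a u v eu ev = close-path c (suc (2 * a)) (s≤s z≤n) u v eu ev

private
  Descent : ∀ {n} → ℕ → ℕ → Fin n → Fin n → Set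
  Descent {n} a d u v = Σ (Walk (SibHeap n) u v) λ w →
    len w ≡ d × All (λ x → a ≤ suc (toℕ x)) (verts w) × Unique (verts w)

  descent : ∀ {n} a s (u v : Fin n) → 1 ≤ a → suc (toℕ u) ≡ a → suc (toℕ v) ≡ descend a s →
            Descent a (length s) u v
  descent-via : ∀ {n} a a′ s (u v : Fin n) → 1 ≤ a′ → a < a′ → TreeR a a′ →
                suc (toℕ u) ≡ a → suc (toℕ v) ≡ descend a′ s → Descent a (suc (length s)) u v
  descent a [] u v _ eu ev with toℕ-injective (suc-injective (trans eu (sym ev)))
  ... | refl = [] , refl , ≤-reflexive (sym eu) ∷ [] , [] ∷ []
  descent a (false ∷ s) u v 1≤a eu ev =
    descent-via a (2 * a) s u v (1≤2a 1≤a) (a<2a 1≤a) (inj₁ refl) eu ev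
  descent a (true ∷ s)  u v 1≤a eu ev =
    descent-via a (suc (2 * a)) s u v (s≤s z≤n) (a<1+2a a) (inj₂ refl) eu ev
  descent-via {n} a a′ s u v 1≤a′ a<a′ tree eu ev
    with vertex-labelled {n} a′ 1≤a′ (≤-trans (descend-≥ a′ s) (label-bound v ev))
  ... | z , ez with descent a′ s z v 1≤a′ ez ev
  ...   | w , len-w , above , unique-w =
    labelled-edge eu ez (inj₁ (inj₁ tree)) ∷ w , cong suc len-w ,
    ≤-reflexive (sym eu) ∷ All.map (≤-trans (<⇒≤ a<a′)) above ,
    All.map u-below above ∷ unique-w
    where
    u-below : ∀ {x} → a′ ≤ suc (toℕ x) → u ≢ x
    u-below a′≤x refl = <⇒≱ a<a′ (≤-trans a′≤x (≤-reflexive eu))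

descending-path : ∀ {n} a s (u v : Fin n) → 1 ≤ a →
                  suc (toℕ u) ≡ a → suc (toℕ v) ≡ descend a s →
                  ShortPath (SibHeap n) u v (length s)
descending-path a s u v 1≤a eu ev with descent a s u v 1≤a eu ev
... | w , len-w , _ , unique-w = path w unique-w , ≤-reflexive len-w

module Embed (m : ℕ) where

  h N : ℕ
  h = suc (suc m)
  N = 2 ^ suc h ∸ 1

  order : List Address
  order = root-first h

  private
    order-length : length order ≡ N
    order-length = cong (_∸ 1) (root-first-length h)

    at-order-fits : ∀ i → descend 1 (at order i) ≤ N
    at-order-fits i = suc[m]≤n⇒m≤pred[n] (begin-strict
      descend 1 s                    ≡⟨ address-label s ⟩
      2 ^ length s + position s      <⟨ level-bounded (length s) (position< s) ⟩
      2 ^ suc (length s)             ≤⟨ ^-monoʳ-≤ 2 (s≤s (at-all order i (root-first-depth h) z≤n)) ⟩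
      2 ^ suc h                      ∎)
      where
      open ≤-Reasoning
      s : Address
      s = at order i

    image : ∀ i → Σ (Fin N) λ u → suc (toℕ u) ≡ descend 1 (at order i)
    image i = vertex-labelled (descend 1 (at order i)) (descend-≥ 1 (at order i)) (at-order-fits i)

  f : Fin N → Fin N
  f i = proj₁ (image (toℕ i))

  f-label : ∀ i → suc (toℕ (f i)) ≡ descend 1 (at order (toℕ i))
  f-label i = proj₂ (image (toℕ i))

  f-injective : Injective _≡_ _≡_ f
  f-injective {i} {j} same = toℕ-injective (at-injective order (toℕ i) (toℕ j) (root-first-unique h)
    (in-range i) (in-range j) (address-injective _ _ same-label))
    where
    in-range : ∀ i → toℕ i < length order
    in-range i = subst (toℕ i <_) (sym order-length) (toℕ<n i)
    same-label : descend 1 (at order (toℕ i)) ≡ descend 1 (at order (toℕ j))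
    same-label = trans (sym (f-label i)) (trans (cong (λ x → suc (toℕ x)) same) (f-label j))

  hub : Fin N
  hub = fromℕ< 0<N
    where
    0<N : 0 < N
    0<N = suc[m]≤n⇒m≤pred[n] (^-monoʳ-≤ 2 {1} {suc h} (s≤s z≤n))

  hub-index : toℕ hub ≡ 0
  hub-index = toℕ-fromℕ< _

  from-root : ∀ u v → toℕ u ≡ 0 → ShortPath (SibHeap N) (f u) (f v) h
  from-root u v u≡0 =
    weaken (at-all order (toℕ v) (root-first-depth h) z≤n)
      (descending-path 1 (at order (toℕ v)) (f u) (f v) (s≤s z≤n)
        (trans (f-label u) (cong (λ i → descend 1 (at order i)) u≡0)) (f-label v))

  consecutive : ∀ u v → toℕ v ≡ suc (toℕ u) → ShortPath (SibHeap N) (f u) (f v) 2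
  consecutive u v v≡1+u =
    close-path (chain-step (root-first-chain h) (toℕ u) in-range) 1 (s≤s z≤n) (f u) (f v)
      (f-label u) (trans (f-label v) (cong (λ i → descend 1 (at order i)) v≡1+u))
    where
    in-range : suc (toℕ u) < length order
    in-range = subst₂ _<_ v≡1+u (sym order-length) (toℕ<n v)

  closing : ∀ u v → toℕ u ≡ 1 → toℕ v ≡ N ∸ 1 → ShortPath (SibHeap N) (f u) (f v) 2
  closing u v u≡1 v≡last =
    close-path second-close-to-last 1 (s≤s z≤n) (f u) (f v)
      (trans (f-label u) (cong (λ i → descend 1 (at order i)) u≡1))
      (trans (f-label v) (cong (λ i → descend 1 (at order i)) v≡last))
    where
    last-entry : at order (N ∸ 1) ≡ true ∷ []
    last-entry = trans (cong (λ n → at order (n ∸ 1)) (sym order-length)) (chain-end (root-first-chain h))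
    second-close-to-last : Close (at order 1) (at order (N ∸ 1))
    second-close-to-last = subst₂ Close (sym (root-first-second m)) (sym last-entry) (flip nephew′)

  data EdgeKind (a b : ℕ) : Set where
    spoke   : a ≡ 0 → EdgeKind a b
    onward  : b ≡ suc a → EdgeKind a b
    closes  : a ≡ 1 → b ≡ N ∸ 1 → EdgeKind a b

  hub-kind : ∀ {a b} → HubR a b → EdgeKind a b
  hub-kind (a≡0 , _) = spoke a≡0

  path-kind : ∀ {a b} → PathR N a b → EdgeKind a b
  path-kind (_ , b≡1+a , _) = onward b≡1+a

  cycle-kind : ∀ {a b} → CloseR N a b → EdgeKind a b
  cycle-kind (a≡1 , b≡last) = closes a≡1 b≡last

  triangle-kind : ∀ {a b} → TriR a b → EdgeKind a b
  triangle-kind (k , 1≤k , a≡2k-1 , b≡2k) =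
    onward (trans b≡2k (trans (sym (suc-pred-pos (1≤2a 1≤k))) (cong suc (sym a≡2k-1))))

  kind-path : ∀ u v → EdgeKind (toℕ u) (toℕ v) → ShortPath (SibHeap N) (f u) (f v) h
  kind-path u v (spoke u≡0)         = from-root u v u≡0
  kind-path u v (onward v≡1+u)      = weaken (s≤s (s≤s z≤n)) (consecutive u v v≡1+u)
  kind-path u v (closes u≡1 v≡last) = weaken (s≤s (s≤s z≤n)) (closing u v u≡1 v≡last)

  either-way : ∀ {R : ℕ → ℕ → Set} → (∀ {a b} → R a b → EdgeKind a b) →
               ∀ u v → Sym R (toℕ u) (toℕ v) → ShortPath (SibHeap N) (f u) (f v) h
  either-way kind u v (inj₁ e) = kind-path u v (kind e)
  either-way kind u v (inj₂ e) = reverse-path sib-sym (kind-path v u (kind e))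

  guest-path : ∀ g u v → guest g N u v → ShortPath (SibHeap N) (f u) (f v) h
  guest-path wheel      = either-way Sum.[ hub-kind , Sum.[ path-kind , cycle-kind ]′ ]′
  guest-path fan        = either-way Sum.[ hub-kind , path-kind ]′
  guest-path friendship = either-way Sum.[ hub-kind , triangle-kind ]′
  guest-path star       = either-way hub-kind

  host-path : ∀ k {u v d} → ShortPath (SibHeap N) u v d → ShortPath (host k (suc h)) u v d
  host-path sibling p = p
  host-path xtree   p = map-path sib⊆x p

  embedding : ∀ g k → Embedding (guest g N) (host k (suc h))
  embedding g k = record
    { f     = f
    ; f-inj = f-injective
    ; P     = λ u v e → proj₁ (host-path k (guest-path g u v e))
    }

  dilation-upper : ∀ g k u v (e : guest g N u v) → dilOf (embedding g k) e ≤ h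
  dilation-upper g k u v e = proj₂ (host-path k (guest-path g u v e))

  far : ∀ k v → Σ (Fin N) λ w → ∀ (p : Path (host k (suc h)) v w) → h ≤ plen p
  far k v with far-vertex h v
  ... | w , long = w , as-x-walk k
    where
    as-x-walk : ∀ k (p : Path (host k (suc h)) v w) → h ≤ plen p
    as-x-walk sibling (path p _) = subst (h ≤_) (len-map-walk sib⊆x p) (long (map-walk sib⊆x p))
    as-x-walk xtree   (path p _) = long p

  radius : ∀ k → Radius (host k (suc h)) h
  radius k = (f hub , reach) , far k
    where
    reach : ∀ w → ShortPath (host k (suc h)) (f hub) w h
    reach w with injective⇒surjective f f-injective w
    ... | v , refl = host-path k (from-root hub v hub-index)

  spoke-edge : ∀ g u → 1 ≤ toℕ u → guest g N hub u
  spoke-edge wheel      u 1≤u = inj₁ (inj₁ (hub-index , 1≤u))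
  spoke-edge fan        u 1≤u = inj₁ (inj₁ (hub-index , 1≤u))
  spoke-edge friendship u 1≤u = inj₁ (inj₁ (hub-index , 1≤u))
  spoke-edge star       u 1≤u = inj₁ (hub-index , 1≤u)

  -- Under any embedding, the image of the hub has a vertex at distance ≥ h;
  -- that vertex is the image of a vertex u ≠ hub, and the spoke hub–u
  -- has dilation at least h.
  dilation-lower : ∀ g k (E : Embedding (guest g N) (host k (suc h))) →
                   Σ _ λ u → Σ _ λ v → Σ (guest g N u v) λ e → h ≤ dilOf E e
  dilation-lower g k E with far k (Embedding.f E hub)
  ... | w , long with injective⇒surjective (Embedding.f E) (Embedding.f-inj E) w
  ...   | u , refl with toℕ u ≟ 0
  ...     | no u≢0  = hub , u , hub-u , long (Embedding.P E hub u hub-u)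
    where
    hub-u : guest g N hub u
    hub-u = spoke-edge g u (n≢0⇒n>0 u≢0)
  ...     | yes u≡0 with toℕ-injective (trans hub-index (sym u≡0))
  ...       | refl with long (path [] ([] ∷ []))
  ...         | ()

theorem2 : (l : ℕ) → 3 ≤ l → (g : GuestKind) → (h : HostKind)
         → Dilation (guest g (2 ^ l ∸ 1)) (host h l) (l ∸ 1) × Radius (host h l) (l ∸ 1)
theorem2 (suc (suc zero)) (s≤s (s≤s ()))
theorem2 (suc (suc (suc m))) _ g k =
  ((embedding g k , dilation-upper g k) , dilation-lower g k) , radius k
  where open Embed m
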